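{- For every integer $n\ge1$, \[ CP_{(1,1)}(n,X,Y)=\prod_{i=1}^{n}\frac{1-X_{i-1}X_{i}Y_{i-1}Y_{i}}{(1-X_{i}Y_{i-1})(1-X_{i-1}Y_{i})(1-X_{i}Y_{i})}. \]
   Context: Let $x_1,x_2,\dots,y_1,y_2,\dots$ be formal variables, $X_i:=x_1\cdots x_i$, $Y_i:=y_1\cdots y_i$ for $i\ge1$, and $X_0=Y_0:=1$. For $n\ge1$, $CP_{(1,1)}(n,X,Y):=\sum \prod_{i=1}^n x_i^{a_i}y_i^{b_i}$, summed over all tuples of nonnegative integers $(a_1,\dots,a_n,b_1,\dots,b_n)$ with $a_1\ge\dots\ge a_n$, $b_1\ge\dots\ge b_n$, $a_j\ge b_{j+1}$ and $b_j\ge a_{j+1}$ for all $j\ge1$, where $a_j=b_j=0$ for $j>n$ (cylindric partitions with profile $(1,1)$ with at most $n$ nonzero entries in each row). -}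

module Defs where

open import Data.Nat using (ℕ; zero; suc; _∸_; _≤ᵇ_; _<ᵇ_)
import Data.Nat as ℕ
open import Data.Integer using (ℤ; 0ℤ; 1ℤ; _+_; _*_; -_)
open import Data.Bool using (Bool; true; false; if_then_else_; _∧_)
open import Data.List using (List; []; _∷_; [_]; map; concatMap; upTo; foldr)
open import Data.Bool.ListAction using (all; any)
open import Data.Vec using (Vec; []; _∷_; _++_; zipWith; tabulate; lookup; splitAt; replicate)
open import Data.Vec.Properties using (≡-dec)
open import Data.Fin using (Fin; toℕ)
open import Data.Product using (_,_; proj₁; proj₂)
open import Relation.Nullary.Decidable using (⌊_⌋)

-- Formal power series over ℤ in m commuting variables z₁,…,z_m.
-- An exponent vector is a Vec ℕ m; a series is its coefficient function.

Exp : ℕ → Set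
Exp m = Vec ℕ m

PS : ℕ → Set
PS m = Exp m → ℤ

below : ∀ {m} → Exp m → List (Exp m)
below [] = [ [] ]
below (k ∷ e) = concatMap (λ i → map (i ∷_) (below e)) (upTo (suc k))

sumℤ : List ℤ → ℤ
sumℤ = foldr _+_ 0ℤ

_*S_ : ∀ {m} → PS m → PS m → PS m
(f *S g) e = sumℤ (map (λ d → f d * g (zipWith _∸_ e d)) (below e))

_-S_ : ∀ {m} → PS m → PS m → PS m
(f -S g) e = f e + - (g e)

eqExp : ∀ {m} → Exp m → Exp m → Bool
eqExp u v = ⌊ ≡-dec Data.Nat._≟_ u v ⌋

boolℤ : Bool → ℤ
boolℤ true = 1ℤ
boolℤ false = 0ℤ

mono : ∀ {m} → Exp m → PS m
mono v e = boolℤ (eqExp v e)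

oneS : ∀ {m} → PS m
oneS {m} = mono (replicate m 0)

prodS : ∀ {m} → List (PS m) → PS m
prodS = foldr _*S_ oneS

scale : ∀ {m} → ℕ → Exp m → Exp m
scale k = Data.Vec.map (k ℕ.*_)

vsum : ∀ {m} → Exp m → ℕ
vsum = Data.Vec.foldr _ ℕ._+_ 0

-- 1/(1 - z^v) = Σ_{k≥0} z^{k v}   (used only for v ≠ 0; a multiple
-- k·v equal to e with v ≠ 0 has k ≤ Σ e, so the search is complete)
geom : ∀ {m} → Exp m → PS m
geom v e = boolℤ (any (λ k → eqExp (scale k v) e) (upTo (suc (vsum e))))

-- Variables x₁..x_n, y₁..y_n: exponent vector = (a₁..a_n) ++ (b₁..b_n).

-- exponent vector (in n variables) of x₁⋯x_i (i.e. of X_i); X₀ = 1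
prefixE : (n i : ℕ) → Vec ℕ n
prefixE n i = tabulate (λ (j : Fin n) → if toℕ j <ᵇ i then 1 else 0)

XY : (n i j : ℕ) → Exp (n ℕ.+ n)
XY n i j = prefixE n i ++ prefixE n j

XXYY : (n i : ℕ) → Exp (n ℕ.+ n)
XXYY n i = zipWith ℕ._+_ (XY n (i ∸ 1) (i ∸ 1)) (XY n i i)

factor : (n i : ℕ) → PS (n ℕ.+ n)
factor n i = ((oneS -S mono (XXYY n i)) *S geom (XY n i (i ∸ 1)))
               *S (geom (XY n (i ∸ 1) i) *S geom (XY n i i))

RHS : (n : ℕ) → PS (n ℕ.+ n)
RHS n = prodS (map (λ j → factor n (suc j)) (upTo n))

-- 0-based access with value 0 beyond the end (a_j = 0 for j > n)
at : ∀ {n} → Vec ℕ n → ℕ → ℕ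
at [] _ = 0
at (x ∷ v) zero = x
at (x ∷ v) (suc k) = at v k

-- a = (a₁,…,a_n), b = (b₁,…,b_n) (0-based here). Conditions for all j:
-- a_j ≥ a_{j+1}, b_j ≥ b_{j+1}, a_j ≥ b_{j+1}, b_j ≥ a_{j+1};
-- for j ≥ n (0-based) both sides' right-hand entries are 0, so only j < n matters.
isCP : ∀ {n} → Vec ℕ n → Vec ℕ n → Bool
isCP {n} a b = all (λ j → (at a (suc j) ≤ᵇ at a j) ∧ (at b (suc j) ≤ᵇ at b j)
                        ∧ (at b (suc j) ≤ᵇ at a j) ∧ (at a (suc j) ≤ᵇ at b j))
                   (upTo n)

CP : (n : ℕ) → PS (n ℕ.+ n)
CP n e = boolℤ (isCP (proj₁ (splitAt n e)) (proj₁ (proj₂ (splitAt n e))))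

-- Index the parts from 0, so that a_j and b_j are the exponents of x_{j+1} and y_{j+1}.
-- Call (a, b) settled at k if it is cylindric from position k on and a_j = b_j = max(a_k, b_k)
-- for all j < k. Only the zero vector is settled at n and the cylindric partitions are the
-- pairs settled at 0, so it suffices that the (k+1)-th factor turns the indicator series of
-- the pairs settled at k + 1 into that of the pairs settled at k. With c = max(a_{k+1}, b_{k+1}),
-- a pair settled at k arises from one settled at k + 1 by raising a_k, b_k by excesses α, β
-- and all earlier parts by max(α, β); for u = X_k Y_k, x = x_{k+1}, y = y_{k+1} this
-- contributes Σ u^max(α,β) x^α y^β = (1 - u²xy) / ((1 - uy)(1 - ux)(1 - uxy)).
-- Multiplying by the four pieces in this order keeps every intermediate series 0/1-valued:
-- 1/(1 - uy) raises b_k and the earlier parts by β (ExcessB), 1/(1 - ux) raises a_k and the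
-- earlier parts by α, leaving them at level α + β (ExcessSum), 1 - u²xy cancels the pairs with
-- α, β > 0 against their shifts (OneSided), and 1/(1 - uxy) raises a_k, b_k and the earlier
-- parts by a common q, which turns the level α + β with min(α, β) = 0 into max(α + q, β + q)
-- (ExcessMax). Each geometric series acts bijectively because the multiple q it contributes
-- can be read off from the excesses of the resulting pair.

module Submission where

open import Defs

open import Data.Bool using (Bool; T; true; false; _∧_)
open import Data.Bool.ListAction using (any)
open import Data.Bool.Properties using (T-≡; T-∧)
open import Data.Integer using (ℤ; 0ℤ; 1ℤ) renaming (_+_ to _+ℤ_; _*_ to _*ℤ_; -_ to -ℤ_)
import Data.Integer.Properties as ℤ
open import Data.List using (List; []; _∷_; _++_; map; concatMap; applyUpTo; upTo)
import Data.List.Properties as List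
open import Data.List.Relation.Unary.All.Properties using (all⁺; all⁻; applyUpTo⁺₁; applyUpTo⁻)
open import Data.List.Relation.Unary.Any using (satisfied)
open import Data.List.Relation.Unary.Any.Properties using (any⁺; any⁻; applyUpTo⁺)
open import Data.Nat
open import Data.Nat.Properties
open import Data.Nat.Tactic.RingSolver using (solve-∀)
open import Data.Product using (_×_; _,_; proj₁; proj₂; ∃-syntax)
open import Data.Product.Function.NonDependent.Propositional using (_×-⇔_)
open import Data.Sum using (_⊎_; inj₁; inj₂)
open import Data.Unit using (tt)
open import Data.Vec as Vec using (Vec; []; _∷_; zipWith; replicate)
import Data.Vec.Properties as Vec
open import Data.Vec.Relation.Binary.Pointwise.Inductive as Pointwise using (Pointwise; []; _∷_)
open import Function using (_∘_; id; _⇔_; mk⇔; Equivalence)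
open import Function.Properties.Equivalence using () renaming (trans to ⇔-trans)
open import Relation.Binary.Definitions using (tri<; tri≈; tri>)
open import Relation.Binary.PropositionalEquality
open import Relation.Nullary using (¬_; Dec; yes; no; contradiction)
open import Relation.Nullary.Decidable using (map′; _×-dec_; toWitness; fromWitness)

open import Algebra.Properties.CommutativeSemigroup ℤ.+-commutativeSemigroup using (interchange)
open import Algebra.Properties.CommutativeSemigroup +-commutativeSemigroup using (xy∙z≈xz∙y)
open ≡-Reasoning

-- Finite sums

∑ : ℕ → (ℕ → ℤ) → ℤ
∑ zero    f = 0ℤ
∑ (suc n) f = f 0 +ℤ ∑ n (f ∘ suc)

∑-cong : ∀ n {f g : ℕ → ℤ} → (∀ i → i < n → f i ≡ g i) → ∑ n f ≡ ∑ n g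
∑-cong zero    f≡g = refl
∑-cong (suc n) f≡g = cong₂ _+ℤ_ (f≡g 0 z<s) (∑-cong n (λ i i<n → f≡g (suc i) (s<s i<n)))

∑-zero : ∀ n {f : ℕ → ℤ} → (∀ i → i < n → f i ≡ 0ℤ) → ∑ n f ≡ 0ℤ
∑-zero zero    f≡0 = refl
∑-zero (suc n) f≡0 = cong₂ _+ℤ_ (f≡0 0 z<s) (∑-zero n (λ i i<n → f≡0 (suc i) (s<s i<n)))

∑-single : ∀ n {f : ℕ → ℤ} {i₀} → i₀ < n → (∀ i → i < n → i ≢ i₀ → f i ≡ 0ℤ) → ∑ n f ≡ f i₀
∑-single (suc n) {f} {zero} _ f≡0 = begin
  f 0 +ℤ ∑ n (f ∘ suc) ≡⟨ cong (f 0 +ℤ_) (∑-zero n (λ i i<n → f≡0 (suc i) (s<s i<n) λ ())) ⟩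
  f 0 +ℤ 0ℤ            ≡⟨ ℤ.+-identityʳ (f 0) ⟩
  f 0                  ∎
∑-single (suc n) {f} {suc i₀} (s<s i₀<n) f≡0 = begin
  f 0 +ℤ ∑ n (f ∘ suc) ≡⟨ cong₂ _+ℤ_ (f≡0 0 z<s λ ()) (∑-single n i₀<n others) ⟩
  0ℤ +ℤ f (suc i₀)     ≡⟨ ℤ.+-identityˡ (f (suc i₀)) ⟩
  f (suc i₀)           ∎
  where
  others : ∀ i → i < n → i ≢ i₀ → f (suc i) ≡ 0ℤ
  others i i<n i≢i₀ = f≡0 (suc i) (s<s i<n) (i≢i₀ ∘ suc-injective)

∑-+ : ∀ n (f g : ℕ → ℤ) → ∑ n (λ i → f i +ℤ g i) ≡ ∑ n f +ℤ ∑ n g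
∑-+ zero    f g = refl
∑-+ (suc n) f g = begin
  (f 0 +ℤ g 0) +ℤ ∑ n (λ i → f (suc i) +ℤ g (suc i))
    ≡⟨ cong ((f 0 +ℤ g 0) +ℤ_) (∑-+ n (f ∘ suc) (g ∘ suc)) ⟩
  (f 0 +ℤ g 0) +ℤ (∑ n (f ∘ suc) +ℤ ∑ n (g ∘ suc))
    ≡⟨ interchange (f 0) (g 0) _ _ ⟩
  ∑ (suc n) f +ℤ ∑ (suc n) g ∎

∑-*ˡ : ∀ n c (f : ℕ → ℤ) → c *ℤ ∑ n f ≡ ∑ n (λ i → c *ℤ f i)
∑-*ˡ zero    c f = ℤ.*-zeroʳ c
∑-*ˡ (suc n) c f = trans (ℤ.*-distribˡ-+ c (f 0) _) (cong (c *ℤ f 0 +ℤ_) (∑-*ˡ n c (f ∘ suc)))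

∑-*ʳ : ∀ n c (f : ℕ → ℤ) → ∑ n f *ℤ c ≡ ∑ n (λ i → f i *ℤ c)
∑-*ʳ zero    c f = ℤ.*-zeroˡ c
∑-*ʳ (suc n) c f = trans (ℤ.*-distribʳ-+ c (f 0) _) (cong (f 0 *ℤ c +ℤ_) (∑-*ʳ n c (f ∘ suc)))

∑-snoc : ∀ n (f : ℕ → ℤ) → ∑ (suc n) f ≡ ∑ n f +ℤ f n
∑-snoc zero    f = trans (ℤ.+-identityʳ (f 0)) (sym (ℤ.+-identityˡ (f 0)))
∑-snoc (suc n) f = begin
  f 0 +ℤ ∑ (suc n) (f ∘ suc)          ≡⟨ cong (f 0 +ℤ_) (∑-snoc n (f ∘ suc)) ⟩
  f 0 +ℤ (∑ n (f ∘ suc) +ℤ f (suc n)) ≡⟨ ℤ.+-assoc (f 0) _ _ ⟨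
  ∑ (suc n) f +ℤ f (suc n)            ∎

∑-reverse : ∀ k (f : ℕ → ℤ) → ∑ (suc k) f ≡ ∑ (suc k) (λ i → f (k ∸ i))
∑-reverse zero    f = refl
∑-reverse (suc k) f = begin
  f 0 +ℤ ∑ (suc k) (f ∘ suc)                   ≡⟨ cong (f 0 +ℤ_) (∑-reverse k (f ∘ suc)) ⟩
  f 0 +ℤ ∑ (suc k) (λ i → f (suc (k ∸ i)))     ≡⟨ ℤ.+-comm (f 0) _ ⟩
  ∑ (suc k) (λ i → f (suc (k ∸ i))) +ℤ f 0     ≡⟨ cong₂ _+ℤ_ (∑-cong (suc k) suc-∸) (cong f (n∸n≡0 k)) ⟨
  ∑ (suc k) (λ i → f (suc k ∸ i)) +ℤ f (k ∸ k) ≡⟨ ∑-snoc (suc k) (λ i → f (suc k ∸ i)) ⟨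
  ∑ (suc (suc k)) (λ i → f (suc k ∸ i))        ∎
  where
  suc-∸ : ∀ i → i < suc k → f (suc k ∸ i) ≡ f (suc (k ∸ i))
  suc-∸ i i<sk = cong f (+-∸-assoc 1 (≤-pred i<sk))

∑-triangle : ∀ k (H : ℕ → ℕ → ℤ) →
  ∑ (suc k) (λ j → ∑ (suc j) (λ i → H i j)) ≡ ∑ (suc k) (λ i → ∑ (suc (k ∸ i)) (λ l → H i (i + l)))
∑-triangle zero    H = refl
∑-triangle (suc k) H = begin
  (H 0 0 +ℤ 0ℤ) +ℤ ∑ (suc k) (λ j → H 0 (suc j) +ℤ ∑ (suc j) (λ i → H (suc i) (suc j)))
    ≡⟨ cong₂ _+ℤ_ (ℤ.+-identityʳ (H 0 0)) (∑-+ (suc k) (H 0 ∘ suc) (λ j → ∑ (suc j) (λ i → H (suc i) (suc j)))) ⟩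
  H 0 0 +ℤ (∑ (suc k) (H 0 ∘ suc) +ℤ ∑ (suc k) (λ j → ∑ (suc j) (λ i → H (suc i) (suc j))))
    ≡⟨ cong (λ x → H 0 0 +ℤ (∑ (suc k) (H 0 ∘ suc) +ℤ x)) (∑-triangle k (λ i j → H (suc i) (suc j))) ⟩
  H 0 0 +ℤ (∑ (suc k) (H 0 ∘ suc) +ℤ ∑ (suc k) (λ i → ∑ (suc (k ∸ i)) (λ l → H (suc i) (suc (i + l)))))
    ≡⟨ ℤ.+-assoc (H 0 0) _ _ ⟨
  ∑ (suc (suc k)) (λ i → ∑ (suc (suc k ∸ i)) (λ l → H i (i + l))) ∎

sumℤ-++ : ∀ (xs ys : List ℤ) → sumℤ (xs ++ ys) ≡ sumℤ xs +ℤ sumℤ ys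
sumℤ-++ []       ys = sym (ℤ.+-identityˡ (sumℤ ys))
sumℤ-++ (x ∷ xs) ys = trans (cong (x +ℤ_) (sumℤ-++ xs ys)) (sym (ℤ.+-assoc x _ _))

sumℤ-map-concatMap : ∀ {A B : Set} (h : B → ℤ) (F : A → List B) (xs : List A) →
  sumℤ (map h (concatMap F xs)) ≡ sumℤ (map (λ x → sumℤ (map h (F x))) xs)
sumℤ-map-concatMap h F []       = refl
sumℤ-map-concatMap h F (x ∷ xs) = begin
  sumℤ (map h (F x ++ concatMap F xs))                ≡⟨ cong sumℤ (List.map-++ h (F x) _) ⟩
  sumℤ (map h (F x) ++ map h (concatMap F xs))        ≡⟨ sumℤ-++ (map h (F x)) _ ⟩
  sumℤ (map h (F x)) +ℤ sumℤ (map h (concatMap F xs)) ≡⟨ cong (sumℤ (map h (F x)) +ℤ_) (sumℤ-map-concatMap h F xs) ⟩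
  sumℤ (map (λ x → sumℤ (map h (F x))) (x ∷ xs))      ∎

sumℤ-map-applyUpTo : ∀ (f : ℕ → ℤ) (g : ℕ → ℕ) n → sumℤ (map f (applyUpTo g n)) ≡ ∑ n (f ∘ g)
sumℤ-map-applyUpTo f g zero    = refl
sumℤ-map-applyUpTo f g (suc n) = cong (f (g 0) +ℤ_) (sumℤ-map-applyUpTo f (g ∘ suc) n)

sumℤ-map-+ : ∀ {A : Set} (f g : A → ℤ) (xs : List A) →
  sumℤ (map (λ x → f x +ℤ g x) xs) ≡ sumℤ (map f xs) +ℤ sumℤ (map g xs)
sumℤ-map-+ f g []       = refl
sumℤ-map-+ f g (x ∷ xs) =
  trans (cong (f x +ℤ g x +ℤ_) (sumℤ-map-+ f g xs)) (interchange (f x) (g x) _ _)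

sumℤ-map-neg : ∀ {A : Set} (f : A → ℤ) (xs : List A) → sumℤ (map (λ x → -ℤ f x) xs) ≡ -ℤ sumℤ (map f xs)
sumℤ-map-neg f []       = refl
sumℤ-map-neg f (x ∷ xs) = trans (cong (-ℤ f x +ℤ_) (sumℤ-map-neg f xs)) (sym (ℤ.neg-distrib-+ (f x) _))

sumℤ-map-∑ : ∀ {A : Set} n (H : ℕ → A → ℤ) (xs : List A) →
  sumℤ (map (λ x → ∑ n (λ i → H i x)) xs) ≡ ∑ n (λ i → sumℤ (map (H i) xs))
sumℤ-map-∑ n H []       = sym (∑-zero n (λ _ _ → refl))
sumℤ-map-∑ n H (x ∷ xs) =
  trans (cong (∑ n (λ i → H i x) +ℤ_) (sumℤ-map-∑ n H xs)) (sym (∑-+ n _ _))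

-- Convolution of power series

infix 4 _≤v_
_≤v_ : ∀ {m} → Exp m → Exp m → Set
_≤v_ = Pointwise _≤_

infixl 6 _⊖_
_⊖_ : ∀ {m} → Exp m → Exp m → Exp m
e ⊖ d = zipWith _∸_ e d

zeros≤v : ∀ {m} (e : Exp m) → replicate m 0 ≤v e
zeros≤v []      = []
zeros≤v (k ∷ e) = z≤n ∷ zeros≤v e

sumBelow : ∀ {m} → Exp m → (Exp m → ℤ) → ℤ
sumBelow e h = sumℤ (map h (below e))

sumBelow-cons : ∀ {m} k (e : Exp m) (h : Exp (suc m) → ℤ) →
  sumBelow (k ∷ e) h ≡ ∑ (suc k) (λ i → sumBelow e (h ∘ (i ∷_)))
sumBelow-cons k e h = begin
  sumℤ (map h (concatMap (λ i → map (i ∷_) (below e)) (upTo (suc k))))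
    ≡⟨ sumℤ-map-concatMap h (λ i → map (i ∷_) (below e)) (upTo (suc k)) ⟩
  sumℤ (map (λ i → sumℤ (map h (map (i ∷_) (below e)))) (upTo (suc k)))
    ≡⟨ sumℤ-map-applyUpTo (λ i → sumℤ (map h (map (i ∷_) (below e)))) id (suc k) ⟩
  ∑ (suc k) (λ i → sumℤ (map h (map (i ∷_) (below e))))
    ≡⟨ ∑-cong (suc k) (λ i _ → cong sumℤ (List.map-∘ {g = h} {f = i ∷_} (below e))) ⟨
  ∑ (suc k) (λ i → sumBelow e (h ∘ (i ∷_))) ∎

sumBelow-zero : ∀ {m} (e : Exp m) {h : Exp m → ℤ} → (∀ d → d ≤v e → h d ≡ 0ℤ) → sumBelow e h ≡ 0ℤ
sumBelow-zero []      h≡0 = cong (_+ℤ 0ℤ) (h≡0 [] [])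
sumBelow-zero (k ∷ e) {h} h≡0 = trans (sumBelow-cons k e h)
  (∑-zero (suc k) λ i i≤k → sumBelow-zero e λ d d≤e → h≡0 (i ∷ d) (≤-pred i≤k ∷ d≤e))

sumBelow-single : ∀ {m} (e : Exp m) {h : Exp m → ℤ} {d₀} → d₀ ≤v e →
  (∀ d → d ≤v e → d ≢ d₀ → h d ≡ 0ℤ) → sumBelow e h ≡ h d₀
sumBelow-single []      {h} [] _ = ℤ.+-identityʳ (h [])
sumBelow-single (k ∷ e) {h} {i₀ ∷ d₀} (i₀≤k ∷ d₀≤e) h≡0 = begin
  sumBelow (k ∷ e) h                        ≡⟨ sumBelow-cons k e h ⟩
  ∑ (suc k) (λ i → sumBelow e (h ∘ (i ∷_))) ≡⟨ ∑-single (suc k) (s≤s i₀≤k) other-heads ⟩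
  sumBelow e (h ∘ (i₀ ∷_))                  ≡⟨ sumBelow-single e d₀≤e other-tails ⟩
  h (i₀ ∷ d₀)                               ∎
  where
  other-heads : ∀ i → i < suc k → i ≢ i₀ → sumBelow e (h ∘ (i ∷_)) ≡ 0ℤ
  other-heads i i≤k i≢i₀ =
    sumBelow-zero e λ d d≤e → h≡0 (i ∷ d) (≤-pred i≤k ∷ d≤e) (i≢i₀ ∘ Vec.∷-injectiveˡ)
  other-tails : ∀ d → d ≤v e → d ≢ d₀ → h (i₀ ∷ d) ≡ 0ℤ
  other-tails d d≤e d≢d₀ = h≡0 (i₀ ∷ d) (i₀≤k ∷ d≤e) (d≢d₀ ∘ Vec.∷-injectiveʳ)

_↓_ : ∀ {m} → PS (suc m) → ℕ → PS m
(f ↓ i) d = f (i ∷ d)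

*S-cons : ∀ {m} (f g : PS (suc m)) k (e : Exp m) →
  (f *S g) (k ∷ e) ≡ ∑ (suc k) (λ i → ((f ↓ i) *S (g ↓ (k ∸ i))) e)
*S-cons f g k e = sumBelow-cons k e (λ d → f d *ℤ g ((k ∷ e) ⊖ d))

*S-congˡ : ∀ {m} {f f' : PS m} (g : PS m) → f ≗ f' → f *S g ≗ f' *S g
*S-congˡ g f≗f' e = cong sumℤ (List.map-cong (λ d → cong (_*ℤ g (e ⊖ d)) (f≗f' d)) (below e))

*S-congʳ : ∀ {m} (f : PS m) {g g' : PS m} → g ≗ g' → f *S g ≗ f *S g'
*S-congʳ f g≗g' e = cong sumℤ (List.map-cong (λ d → cong (f d *ℤ_) (g≗g' (e ⊖ d))) (below e))

*S-comm : ∀ {m} (f g : PS m) → f *S g ≗ g *S f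
*S-comm f g []      = cong (_+ℤ 0ℤ) (ℤ.*-comm (f []) (g []))
*S-comm f g (k ∷ e) = begin
  (f *S g) (k ∷ e)
    ≡⟨ *S-cons f g k e ⟩
  ∑ (suc k) (λ i → ((f ↓ i) *S (g ↓ (k ∸ i))) e)
    ≡⟨ ∑-cong (suc k) (λ i _ → *S-comm (f ↓ i) (g ↓ (k ∸ i)) e) ⟩
  ∑ (suc k) (λ i → ((g ↓ (k ∸ i)) *S (f ↓ i)) e)
    ≡⟨ ∑-reverse k (λ i → ((g ↓ (k ∸ i)) *S (f ↓ i)) e) ⟩
  ∑ (suc k) (λ i → ((g ↓ (k ∸ (k ∸ i))) *S (f ↓ (k ∸ i))) e)
    ≡⟨ ∑-cong (suc k) k∸[k∸i]≡i ⟩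
  ∑ (suc k) (λ i → ((g ↓ i) *S (f ↓ (k ∸ i))) e)
    ≡⟨ *S-cons g f k e ⟨
  (g *S f) (k ∷ e) ∎
  where
  k∸[k∸i]≡i : ∀ i → i < suc k → ((g ↓ (k ∸ (k ∸ i))) *S (f ↓ (k ∸ i))) e ≡ ((g ↓ i) *S (f ↓ (k ∸ i))) e
  k∸[k∸i]≡i i i≤k = cong (λ j → ((g ↓ j) *S (f ↓ (k ∸ i))) e) (m∸[m∸n]≡n (≤-pred i≤k))

∑-*S : ∀ {m} n (φ : ℕ → PS m) (g : PS m) →
  (λ d → ∑ n (λ i → φ i d)) *S g ≗ (λ e → ∑ n (λ i → (φ i *S g) e))
∑-*S n φ g e = trans (cong sumℤ (List.map-cong (λ d → ∑-*ʳ n (g (e ⊖ d)) (λ i → φ i d)) (below e)))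
                     (sumℤ-map-∑ n (λ i d → φ i d *ℤ g (e ⊖ d)) (below e))

*S-∑ : ∀ {m} n (f : PS m) (φ : ℕ → PS m) →
  f *S (λ d → ∑ n (λ i → φ i d)) ≗ (λ e → ∑ n (λ i → (f *S φ i) e))
*S-∑ n f φ e = trans (cong sumℤ (List.map-cong (λ d → ∑-*ˡ n (f d) (λ i → φ i (e ⊖ d))) (below e)))
                     (sumℤ-map-∑ n (λ i d → f d *ℤ φ i (e ⊖ d)) (below e))

*S-assoc : ∀ {m} (f g h : PS m) → (f *S g) *S h ≗ f *S (g *S h)
*S-assoc f g h [] = begin
  (f [] *ℤ g [] +ℤ 0ℤ) *ℤ h [] +ℤ 0ℤ   ≡⟨ cong (λ x → x *ℤ h [] +ℤ 0ℤ) (ℤ.+-identityʳ (f [] *ℤ g [])) ⟩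
  (f [] *ℤ g []) *ℤ h [] +ℤ 0ℤ         ≡⟨ cong (_+ℤ 0ℤ) (ℤ.*-assoc (f []) (g []) (h [])) ⟩
  f [] *ℤ (g [] *ℤ h []) +ℤ 0ℤ         ≡⟨ cong (λ x → f [] *ℤ x +ℤ 0ℤ) (ℤ.+-identityʳ (g [] *ℤ h [])) ⟨
  f [] *ℤ (g [] *ℤ h [] +ℤ 0ℤ) +ℤ 0ℤ   ∎
*S-assoc f g h (k ∷ e) = begin
  ((f *S g) *S h) (k ∷ e)
    ≡⟨ *S-cons (f *S g) h k e ⟩
  ∑ (suc k) (λ j → (((f *S g) ↓ j) *S (h ↓ (k ∸ j))) e)
    ≡⟨ ∑-cong (suc k) (λ j _ → expand-left j) ⟩
  ∑ (suc k) (λ j → ∑ (suc j) (λ i → (((f ↓ i) *S (g ↓ (j ∸ i))) *S (h ↓ (k ∸ j))) e))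
    ≡⟨ ∑-cong (suc k) (λ j _ → ∑-cong (suc j) (λ i _ → *S-assoc (f ↓ i) (g ↓ (j ∸ i)) (h ↓ (k ∸ j)) e)) ⟩
  ∑ (suc k) (λ j → ∑ (suc j) (λ i → ((f ↓ i) *S ((g ↓ (j ∸ i)) *S (h ↓ (k ∸ j)))) e))
    ≡⟨ ∑-triangle k (λ i j → ((f ↓ i) *S ((g ↓ (j ∸ i)) *S (h ↓ (k ∸ j)))) e) ⟩
  ∑ (suc k) (λ i → ∑ (suc (k ∸ i)) (λ l → ((f ↓ i) *S ((g ↓ (i + l ∸ i)) *S (h ↓ (k ∸ (i + l))))) e))
    ≡⟨ ∑-cong (suc k) (λ i _ → ∑-cong (suc (k ∸ i)) (λ l _ → reindex i l)) ⟩
  ∑ (suc k) (λ i → ∑ (suc (k ∸ i)) (λ l → ((f ↓ i) *S ((g ↓ l) *S (h ↓ (k ∸ i ∸ l)))) e))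
    ≡⟨ ∑-cong (suc k) (λ i _ → expand-right i) ⟨
  ∑ (suc k) (λ i → ((f ↓ i) *S ((g *S h) ↓ (k ∸ i))) e)
    ≡⟨ *S-cons f (g *S h) k e ⟨
  (f *S (g *S h)) (k ∷ e) ∎
  where
  expand-left : ∀ j → (((f *S g) ↓ j) *S (h ↓ (k ∸ j))) e
                    ≡ ∑ (suc j) (λ i → (((f ↓ i) *S (g ↓ (j ∸ i))) *S (h ↓ (k ∸ j))) e)
  expand-left j = trans (*S-congˡ (h ↓ (k ∸ j)) (*S-cons f g j) e)
                        (∑-*S (suc j) (λ i → (f ↓ i) *S (g ↓ (j ∸ i))) (h ↓ (k ∸ j)) e)
  expand-right : ∀ i → ((f ↓ i) *S ((g *S h) ↓ (k ∸ i))) e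
                     ≡ ∑ (suc (k ∸ i)) (λ l → ((f ↓ i) *S ((g ↓ l) *S (h ↓ (k ∸ i ∸ l)))) e)
  expand-right i = trans (*S-congʳ (f ↓ i) (*S-cons g h (k ∸ i)) e)
                         (*S-∑ (suc (k ∸ i)) (f ↓ i) (λ l → (g ↓ l) *S (h ↓ (k ∸ i ∸ l))) e)
  reindex : ∀ i l → ((f ↓ i) *S ((g ↓ (i + l ∸ i)) *S (h ↓ (k ∸ (i + l))))) e
                  ≡ ((f ↓ i) *S ((g ↓ l) *S (h ↓ (k ∸ i ∸ l)))) e
  reindex i l = cong₂ (λ a b → ((f ↓ i) *S ((g ↓ a) *S (h ↓ b))) e) (m+n∸m≡n i l) (sym (∸-+-assoc k i l))

*S-swap : ∀ {m} (f g h : PS m) → f *S (g *S h) ≗ g *S (f *S h)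
*S-swap f g h e = trans (sym (*S-assoc f g h e)) (trans (*S-congˡ h (*S-comm f g) e) (*S-assoc g f h e))

*S-reorder : ∀ {m} (A U V W T : PS m) → ((A *S U) *S (V *S W)) *S T ≗ W *S (A *S (U *S (V *S T)))
*S-reorder A U V W T e = begin
  (((A *S U) *S (V *S W)) *S T) e ≡⟨ *S-assoc (A *S U) (V *S W) T e ⟩
  ((A *S U) *S ((V *S W) *S T)) e ≡⟨ *S-congʳ (A *S U) (λ d → trans (*S-assoc V W T d) (*S-swap V W T d)) e ⟩
  ((A *S U) *S (W *S (V *S T))) e ≡⟨ *S-assoc A U (W *S (V *S T)) e ⟩
  (A *S (U *S (W *S (V *S T)))) e ≡⟨ *S-congʳ A (*S-swap U W (V *S T)) e ⟩
  (A *S (W *S (U *S (V *S T)))) e ≡⟨ *S-swap A W (U *S (V *S T)) e ⟩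
  (W *S (A *S (U *S (V *S T)))) e ∎

-S-*S : ∀ {m} (f g h : PS m) e → ((f -S g) *S h) e ≡ (f *S h) e +ℤ -ℤ (g *S h) e
-S-*S f g h e = begin
  sumBelow e (λ d → (f d +ℤ -ℤ g d) *ℤ h (e ⊖ d))
    ≡⟨ cong sumℤ (List.map-cong distrib (below e)) ⟩
  sumBelow e (λ d → f d *ℤ h (e ⊖ d) +ℤ -ℤ (g d *ℤ h (e ⊖ d)))
    ≡⟨ sumℤ-map-+ _ _ (below e) ⟩
  (f *S h) e +ℤ sumBelow e (λ d → -ℤ (g d *ℤ h (e ⊖ d)))
    ≡⟨ cong ((f *S h) e +ℤ_) (sumℤ-map-neg _ (below e)) ⟩
  (f *S h) e +ℤ -ℤ (g *S h) e ∎
  where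
  distrib : ∀ d → (f d +ℤ -ℤ g d) *ℤ h (e ⊖ d) ≡ f d *ℤ h (e ⊖ d) +ℤ -ℤ (g d *ℤ h (e ⊖ d))
  distrib d = trans (ℤ.*-distribʳ-+ (h (e ⊖ d)) (f d) (-ℤ g d))
                    (cong (f d *ℤ h (e ⊖ d) +ℤ_) (sym (ℤ.neg-distribˡ-* (g d) (h (e ⊖ d)))))

-- Indicator series

Indicator : ∀ {m} → PS m → (Exp m → Set) → Set
Indicator S Π = ∀ e → (S e ≡ 1ℤ × Π e) ⊎ (S e ≡ 0ℤ × ¬ Π e)

module _ {m} {S : PS m} {Π : Exp m → Set} (S-Π : Indicator S Π) where

  indicator-one : ∀ {e} → Π e → S e ≡ 1ℤ
  indicator-one {e} π with S-Π e
  ... | inj₁ (S≡1 , _)  = S≡1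
  ... | inj₂ (_ , ¬π)   = contradiction π ¬π

  indicator-zero : ∀ {e} → ¬ Π e → S e ≡ 0ℤ
  indicator-zero {e} ¬π with S-Π e
  ... | inj₁ (_ , π)    = contradiction π ¬π
  ... | inj₂ (S≡0 , _)  = S≡0

  indicator-dec : ∀ e → Dec (Π e)
  indicator-dec e with S-Π e
  ... | inj₁ (_ , π)  = yes π
  ... | inj₂ (_ , ¬π) = no ¬π

Indicator-cong : ∀ {m} {S S' : PS m} {Π} → S ≗ S' → Indicator S Π → Indicator S' Π
Indicator-cong S≗S' S-Π e with S-Π e
... | inj₁ (S≡1 , π)  = inj₁ (trans (sym (S≗S' e)) S≡1 , π)
... | inj₂ (S≡0 , ¬π) = inj₂ (trans (sym (S≗S' e)) S≡0 , ¬π)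

Indicator-⇔ : ∀ {m} {S : PS m} {Π Π'} → (∀ e → Π e ⇔ Π' e) → Indicator S Π → Indicator S Π'
Indicator-⇔ Π⇔Π' S-Π e with S-Π e
... | inj₁ (S≡1 , π)  = inj₁ (S≡1 , Equivalence.to (Π⇔Π' e) π)
... | inj₂ (S≡0 , ¬π) = inj₂ (S≡0 , ¬π ∘ Equivalence.from (Π⇔Π' e))

Indicator-unique : ∀ {m} {S S' : PS m} {Π} → Indicator S Π → Indicator S' Π → S ≗ S'
Indicator-unique S-Π S'-Π e with S-Π e
... | inj₁ (S≡1 , π)  = trans S≡1 (sym (indicator-one S'-Π π))
... | inj₂ (S≡0 , ¬π) = trans S≡0 (sym (indicator-zero S'-Π ¬π))

boolℤ-indicator : ∀ {m} (f : Exp m → Bool) {Π : Exp m → Set} → (∀ e → T (f e) ⇔ Π e) →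
  Indicator (λ e → boolℤ (f e)) Π
boolℤ-indicator f T⇔Π e with f e | T⇔Π e
... | true  | t⇔π = inj₁ (refl , Equivalence.to t⇔π tt)
... | false | f⇔π = inj₂ (refl , Equivalence.from f⇔π)

mono-indicator : ∀ {m} (u : Exp m) → Indicator (mono u) (u ≡_)
mono-indicator u = boolℤ-indicator (eqExp u) (λ e → mk⇔ toWitness fromWitness)

mono-*S-≤ : ∀ {m} {u e : Exp m} (S : PS m) → u ≤v e → (mono u *S S) e ≡ S (e ⊖ u)
mono-*S-≤ {u = u} {e} S u≤e = begin
  sumBelow e (λ d → mono u d *ℤ S (e ⊖ d)) ≡⟨ sumBelow-single e u≤e (λ d _ d≢u → vanish (d≢u ∘ sym)) ⟩
  mono u u *ℤ S (e ⊖ u)                    ≡⟨ cong (_*ℤ S (e ⊖ u)) (indicator-one (mono-indicator u) refl) ⟩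
  1ℤ *ℤ S (e ⊖ u)                          ≡⟨ ℤ.*-identityˡ (S (e ⊖ u)) ⟩
  S (e ⊖ u)                                ∎
  where
  vanish : ∀ {d} → u ≢ d → mono u d *ℤ S (e ⊖ d) ≡ 0ℤ
  vanish {d} u≢d =
    trans (cong (_*ℤ S (e ⊖ d)) (indicator-zero (mono-indicator u) u≢d)) (ℤ.*-zeroˡ (S (e ⊖ d)))

mono-*S-≰ : ∀ {m} {u e : Exp m} (S : PS m) → ¬ u ≤v e → (mono u *S S) e ≡ 0ℤ
mono-*S-≰ {u = u} {e} S u≰e = sumBelow-zero e vanish
  where
  vanish : ∀ d → d ≤v e → mono u d *ℤ S (e ⊖ d) ≡ 0ℤ
  vanish d d≤e = trans (cong (_*ℤ S (e ⊖ d)) (indicator-zero (mono-indicator u) u≢d)) (ℤ.*-zeroˡ (S (e ⊖ d)))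
    where
    u≢d : u ≢ d
    u≢d u≡d = u≰e (subst (_≤v e) (sym u≡d) d≤e)

oneS-*S : ∀ {m} (S : PS m) → oneS *S S ≗ S
oneS-*S S e = trans (mono-*S-≤ S (zeros≤v e)) (cong S (Vec.zipWith-identityʳ (λ _ → refl) e))

mono-*S-vanishes : ∀ {m} {u e : Exp m} {S : PS m} {Π} → Indicator S Π →
  ¬ (u ≤v e × Π (e ⊖ u)) → (mono u *S S) e ≡ 0ℤ
mono-*S-vanishes {u = u} {e} {S} S-Π ¬shifted with Pointwise.decidable _≤?_ u e
... | yes u≤e = trans (mono-*S-≤ S u≤e) (indicator-zero S-Π (λ π → ¬shifted (u≤e , π)))
... | no u≰e  = mono-*S-≰ S u≰e

one-minus-mono-*S-indicator : ∀ {m} (u : Exp m) {S : PS m} {Π Π' : Exp m → Set} →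
  Indicator S Π →
  (∀ e → Π' e → Π e) →
  (∀ e → Π e → Π' e ⊎ (u ≤v e × Π (e ⊖ u))) →
  (∀ e → u ≤v e → Π (e ⊖ u) → Π e × ¬ Π' e) →
  Indicator ((oneS -S mono u) *S S) Π'
one-minus-mono-*S-indicator u {S} {Π} {Π'} S-Π Π'⇒Π Π⇒Π'⊎shifted shifted⇒Π∖Π' e =
  conclude (Pointwise.decidable _≤?_ u e ×-dec indicator-dec S-Π (e ⊖ u))
  where
  difference : ((oneS -S mono u) *S S) e ≡ S e +ℤ -ℤ (mono u *S S) e
  difference = trans (-S-*S oneS (mono u) S e) (cong (_+ℤ -ℤ (mono u *S S) e) (oneS-*S S e))

  unchanged : ¬ (u ≤v e × Π (e ⊖ u)) → ((oneS -S mono u) *S S) e ≡ S e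
  unchanged ¬shifted = begin
    ((oneS -S mono u) *S S) e ≡⟨ difference ⟩
    S e +ℤ -ℤ (mono u *S S) e ≡⟨ cong (λ x → S e +ℤ -ℤ x) (mono-*S-vanishes S-Π ¬shifted) ⟩
    S e +ℤ 0ℤ                 ≡⟨ ℤ.+-identityʳ (S e) ⟩
    S e                       ∎

  conclude : Dec (u ≤v e × Π (e ⊖ u)) →
    (((oneS -S mono u) *S S) e ≡ 1ℤ × Π' e) ⊎ (((oneS -S mono u) *S S) e ≡ 0ℤ × ¬ Π' e)
  conclude (yes (u≤e , π)) = inj₂ (cancels , proj₂ (shifted⇒Π∖Π' e u≤e π))
    where
    cancels : ((oneS -S mono u) *S S) e ≡ 0ℤ
    cancels = begin
      ((oneS -S mono u) *S S) e      ≡⟨ difference ⟩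
      S e +ℤ -ℤ (mono u *S S) e      ≡⟨ cong (λ x → S e +ℤ -ℤ x) (mono-*S-≤ S u≤e) ⟩
      S e +ℤ -ℤ S (e ⊖ u)            ≡⟨ cong₂ (λ x y → x +ℤ -ℤ y) (indicator-one S-Π (proj₁ (shifted⇒Π∖Π' e u≤e π)))
                                                                 (indicator-one S-Π π) ⟩
      0ℤ                             ∎
  conclude (no ¬shifted) with S-Π e
  ... | inj₁ (S≡1 , π)  = inj₁ (trans (unchanged ¬shifted) S≡1 , survives (Π⇒Π'⊎shifted e π))
    where
    survives : Π' e ⊎ (u ≤v e × Π (e ⊖ u)) → Π' e
    survives (inj₁ π')      = π'
    survives (inj₂ shifted) = contradiction shifted ¬shifted
  ... | inj₂ (S≡0 , ¬π) = inj₂ (trans (unchanged ¬shifted) S≡0 , ¬π ∘ Π'⇒Π e)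

vsum-scale : ∀ {m} q (v : Exp m) → vsum (scale q v) ≡ q * vsum v
vsum-scale q []      = sym (*-zeroʳ q)
vsum-scale q (x ∷ v) = trans (cong (q * x +_) (vsum-scale q v)) (sym (*-distribˡ-+ q x (vsum v)))

scale-null : ∀ {m} (v : Exp m) k → vsum v ≡ 0 → scale k v ≡ replicate m 0
scale-null []      k _      = refl
scale-null (x ∷ v) k Σv≡0 =
  cong₂ _∷_ (trans (cong (k *_) (m+n≡0⇒m≡0 x Σv≡0)) (*-zeroʳ k)) (scale-null v k (m+n≡0⇒n≡0 x Σv≡0))

geom-hit : ∀ {m} (v d : Exp m) k → k ≤ vsum d → scale k v ≡ d → geom v d ≡ 1ℤ
geom-hit v d k k≤Σd kv≡d =
  cong boolℤ (Equivalence.to T-≡ (any⁺ (λ j → eqExp (scale j v) d) (applyUpTo⁺ id (fromWitness kv≡d) (s≤s k≤Σd))))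

-- For v = 0, geom v is the monomial 1 rather than 1/(1 - 1), but it still takes the value 1
-- at scale q v = 0.
geom-scale : ∀ {m} (v : Exp m) q → geom v (scale q v) ≡ 1ℤ
geom-scale v q with vsum v in Σv
... | zero  = geom-hit v (scale q v) 0 z≤n (trans (scale-null v 0 Σv) (sym (scale-null v q Σv)))
... | suc s = geom-hit v (scale q v) q q≤Σqv refl
  where
  q≤Σqv : q ≤ vsum (scale q v)
  q≤Σqv = subst (q ≤_) (sym (trans (vsum-scale q v) (cong (q *_) Σv))) (m≤m*n q (suc s))

geom-support : ∀ {m} (v d : Exp m) → geom v d ≡ 0ℤ ⊎ ∃[ q ] d ≡ scale q v
geom-support v d with any (λ k → eqExp (scale k v) d) (upTo (suc (vsum d))) in hits
... | false = inj₁ refl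
... | true  with satisfied (any⁻ (λ k → eqExp (scale k v) d) (upTo (suc (vsum d))) (Equivalence.from T-≡ hits))
...   | q , hit = inj₂ (q , sym (toWitness hit))

-- A term geom v d * S (e ⊖ d) can only be nonzero for d = scale q v with Π (e ⊖ d), and then
-- `merge` forces q = quota e: the convolution has at most one nonzero term.
geom-*S-indicator : ∀ {m} (v : Exp m) {S : PS m} {Π Π' : Exp m → Set} (quota : Exp m → ℕ) →
  Indicator S Π →
  (∀ e → Π' e → scale (quota e) v ≤v e × Π (e ⊖ scale (quota e) v)) →
  (∀ e q → scale q v ≤v e → Π (e ⊖ scale q v) → Π' e × q ≡ quota e) →
  Indicator (geom v *S S) Π'
geom-*S-indicator {m} v {S} {Π} {Π'} quota S-Π split merge e = conclude decide
  where
  d₀ : Exp m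
  d₀ = scale (quota e) v

  term : Exp m → ℤ
  term d = geom v d *ℤ S (e ⊖ d)

  decide : Dec (Π' e)
  decide = map′ (λ (d₀≤e , π) → proj₁ (merge e (quota e) d₀≤e π)) (split e)
                (Pointwise.decidable _≤?_ d₀ e ×-dec indicator-dec S-Π (e ⊖ d₀))

  survivor : ∀ d → d ≤v e → term d ≡ 0ℤ ⊎ (d ≡ d₀ × Π' e)
  survivor d d≤e with geom-support v d
  ... | inj₁ g≡0 = inj₁ (trans (cong (_*ℤ S (e ⊖ d)) g≡0) (ℤ.*-zeroˡ (S (e ⊖ d))))
  ... | inj₂ (q , refl) with indicator-dec S-Π (e ⊖ scale q v)
  ...   | no ¬π =
    inj₁ (trans (cong (geom v (scale q v) *ℤ_) (indicator-zero S-Π ¬π)) (ℤ.*-zeroʳ (geom v (scale q v))))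
  ...   | yes π with merge e q d≤e π
  ...     | π' , q≡ = inj₂ (cong (λ q → scale q v) q≡ , π')

  conclude : Dec (Π' e) → ((geom v *S S) e ≡ 1ℤ × Π' e) ⊎ ((geom v *S S) e ≡ 0ℤ × ¬ Π' e)
  conclude (yes π') = inj₁ (value , π')
    where
    only-d₀ : ∀ d → d ≤v e → d ≢ d₀ → term d ≡ 0ℤ
    only-d₀ d d≤e d≢d₀ with survivor d d≤e
    ... | inj₁ vanishes   = vanishes
    ... | inj₂ (d≡d₀ , _) = contradiction d≡d₀ d≢d₀
    value : (geom v *S S) e ≡ 1ℤ
    value = begin
      sumBelow e term         ≡⟨ sumBelow-single e (proj₁ (split e π')) only-d₀ ⟩
      geom v d₀ *ℤ S (e ⊖ d₀) ≡⟨ cong₂ _*ℤ_ (geom-scale v (quota e)) (indicator-one S-Π (proj₂ (split e π'))) ⟩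
      1ℤ                      ∎
  conclude (no ¬π') = inj₂ (sumBelow-zero e none , ¬π')
    where
    none : ∀ d → d ≤v e → term d ≡ 0ℤ
    none d d≤e with survivor d d≤e
    ... | inj₁ vanishes = vanishes
    ... | inj₂ (_ , π') = contradiction π' ¬π'

-- The two rows of an exponent vector

at-zipWith : ∀ {n} (f : ℕ → ℕ → ℕ) → f 0 0 ≡ 0 → (u w : Vec ℕ n) (j : ℕ) →
  at (zipWith f u w) j ≡ f (at u j) (at w j)
at-zipWith f f00 []      []      j       = sym f00
at-zipWith f f00 (x ∷ u) (y ∷ w) zero    = refl
at-zipWith f f00 (x ∷ u) (y ∷ w) (suc j) = at-zipWith f f00 u w j

at-map : ∀ {n} (f : ℕ → ℕ) → f 0 ≡ 0 → (u : Vec ℕ n) (j : ℕ) → at (Vec.map f u) j ≡ f (at u j)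
at-map f f0 []      j       = sym f0
at-map f f0 (x ∷ u) zero    = refl
at-map f f0 (x ∷ u) (suc j) = at-map f f0 u j

at-beyond : ∀ {n} (u : Vec ℕ n) (j : ℕ) → n ≤ j → at u j ≡ 0
at-beyond []      j       _         = refl
at-beyond (x ∷ u) (suc j) (s≤s n≤j) = at-beyond u j n≤j

at-replicate : ∀ n j → at (replicate n 0) j ≡ 0
at-replicate zero    j       = refl
at-replicate (suc n) zero    = refl
at-replicate (suc n) (suc j) = at-replicate n j

at-mono-≤ : ∀ {n} {u w : Vec ℕ n} → u ≤v w → ∀ j → at u j ≤ at w j
at-mono-≤ []        j       = z≤n
at-mono-≤ (x≤y ∷ _) zero    = x≤y
at-mono-≤ (_ ∷ u≤w) (suc j) = at-mono-≤ u≤w j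

at-≤⇒≤v : ∀ {n} (u w : Vec ℕ n) → (∀ j → at u j ≤ at w j) → u ≤v w
at-≤⇒≤v []      []      _   = []
at-≤⇒≤v (x ∷ u) (y ∷ w) u≤w = u≤w 0 ∷ at-≤⇒≤v u w (u≤w ∘ suc)

at-ext : ∀ {n} (u w : Vec ℕ n) → (∀ j → at u j ≡ at w j) → u ≡ w
at-ext []      []      _   = refl
at-ext (x ∷ u) (y ∷ w) u≡w = cong₂ _∷_ (u≡w 0) (at-ext u w (u≡w ∘ suc))

at-prefix-< : ∀ n i j → j < i → i ≤ n → at (prefixE n i) j ≡ 1
at-prefix-< (suc n) (suc i) zero    _         _         = refl
at-prefix-< (suc n) (suc i) (suc j) (s≤s j<i) (s≤s i≤n) = at-prefix-< n i j j<i i≤n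

at-prefix-≥ : ∀ n i j → i ≤ j → at (prefixE n i) j ≡ 0
at-prefix-≥ zero    i       j       _         = refl
at-prefix-≥ (suc n) zero    zero    _         = refl
at-prefix-≥ (suc n) zero    (suc j) _         = at-prefix-≥ n zero j z≤n
at-prefix-≥ (suc n) (suc i) (suc j) (s≤s i≤j) = at-prefix-≥ n i j i≤j

data Side : Set where
  first second : Side

half : Side → ∀ n → Exp (n + n) → Vec ℕ n
half first  n = Vec.take n
half second n = Vec.drop n

row : Side → ∀ n → Exp (n + n) → ℕ → ℕ
row s n e = at (half s n e)

half-zipWith : ∀ s n (f : ℕ → ℕ → ℕ) (u w : Exp (n + n)) →
  half s n (zipWith f u w) ≡ zipWith f (half s n u) (half s n w)
half-zipWith first  n f u w = Vec.take-zipWith f u w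
half-zipWith second n f u w = Vec.drop-zipWith f u w

half-map : ∀ s n (f : ℕ → ℕ) (u : Exp (n + n)) → half s n (Vec.map f u) ≡ Vec.map f (half s n u)
half-map first  n f u = Vec.take-map f n u
half-map second n f u = Vec.drop-map f n u

half-mono-≤ : ∀ s n {u w : Exp (n + n)} → u ≤v w → half s n u ≤v half s n w
half-mono-≤ first  n = take-mono n
  where
  take-mono : ∀ n {m} {u w : Vec ℕ (n + m)} → u ≤v w → Vec.take n u ≤v Vec.take n w
  take-mono zero    _           = []
  take-mono (suc n) (x≤y ∷ u≤w) = x≤y ∷ take-mono n u≤w
half-mono-≤ second n = drop-mono n
  where
  drop-mono : ∀ n {m} {u w : Vec ℕ (n + m)} → u ≤v w → Vec.drop n u ≤v Vec.drop n w
  drop-mono zero    u≤w       = u≤w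
  drop-mono (suc n) (_ ∷ u≤w) = drop-mono n u≤w

half-++ : ∀ n (u w : Vec ℕ n) → half first n (u Vec.++ w) ≡ u × half second n (u Vec.++ w) ≡ w
half-++ n u w = Vec.++-injective (Vec.take n (u Vec.++ w)) u (Vec.take++drop≡id n (u Vec.++ w))

row-zipWith : ∀ s n (f : ℕ → ℕ → ℕ) → f 0 0 ≡ 0 → (u w : Exp (n + n)) (j : ℕ) →
  row s n (zipWith f u w) j ≡ f (row s n u j) (row s n w j)
row-zipWith s n f f00 u w j =
  trans (cong (λ x → at x j) (half-zipWith s n f u w)) (at-zipWith f f00 (half s n u) (half s n w) j)

row-map : ∀ s n (f : ℕ → ℕ) → f 0 ≡ 0 → (u : Exp (n + n)) (j : ℕ) → row s n (Vec.map f u) j ≡ f (row s n u j)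
row-map s n f f0 u j = trans (cong (λ x → at x j) (half-map s n f u)) (at-map f f0 (half s n u) j)

row-beyond : ∀ s n (e : Exp (n + n)) (j : ℕ) → n ≤ j → row s n e j ≡ 0
row-beyond s n e = at-beyond (half s n e)

row-zeros : ∀ s n j → row s n (replicate (n + n) 0) j ≡ 0
row-zeros first  n j = trans (cong (λ x → at x j) (zeros-take n)) (at-replicate n j)
  where
  zeros-take : ∀ n {m} → Vec.take n (replicate (n + m) 0) ≡ replicate n 0
  zeros-take zero    = refl
  zeros-take (suc n) = cong (0 ∷_) (zeros-take n)
row-zeros second n j = trans (cong (λ x → at x j) (zeros-drop n)) (at-replicate n j)
  where
  zeros-drop : ∀ n {m} → Vec.drop n (replicate (n + m) 0) ≡ replicate m 0
  zeros-drop zero    = refl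
  zeros-drop (suc n) = zeros-drop n

row-XY : ∀ n i i' (j : ℕ) →
  row first n (XY n i i') j ≡ at (prefixE n i) j × row second n (XY n i i') j ≡ at (prefixE n i') j
row-XY n i i' j = cong (λ u → at u j) (proj₁ (half-++ n (prefixE n i) (prefixE n i')))
                , cong (λ u → at u j) (proj₂ (half-++ n (prefixE n i) (prefixE n i')))

rows-ext : ∀ n (u w : Exp (n + n)) → (∀ s j → row s n u j ≡ row s n w j) → u ≡ w
rows-ext n u w u≡w = begin
  u                                ≡⟨ Vec.take++drop≡id n u ⟨
  Vec.take n u Vec.++ Vec.drop n u ≡⟨ cong₂ Vec._++_ (at-ext (Vec.take n u) (Vec.take n w) (u≡w first))
                                                      (at-ext (Vec.drop n u) (Vec.drop n w) (u≡w second)) ⟩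
  Vec.take n w Vec.++ Vec.drop n w ≡⟨ Vec.take++drop≡id n w ⟩
  w                                ∎

rows-≤⇒≤v : ∀ n (u w : Exp (n + n)) → (∀ s j → row s n u j ≤ row s n w j) → u ≤v w
rows-≤⇒≤v n u w u≤w = subst₂ _≤v_ (Vec.take++drop≡id n u) (Vec.take++drop≡id n w)
  (Pointwise.++⁺ (at-≤⇒≤v (Vec.take n u) (Vec.take n w) (u≤w first))
                 (at-≤⇒≤v (Vec.drop n u) (Vec.drop n w) (u≤w second)))

row-⊖ : ∀ s n {v e : Exp (n + n)} → v ≤v e → ∀ j → row s n e j ≡ row s n (e ⊖ v) j + row s n v j
row-⊖ s n {v} {e} v≤e j = sym (begin
  row s n (e ⊖ v) j + row s n v j           ≡⟨ cong (_+ row s n v j) (row-zipWith s n _∸_ refl e v j) ⟩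
  (row s n e j ∸ row s n v j) + row s n v j ≡⟨ m∸n+n≡m (at-mono-≤ (half-mono-≤ s n v≤e) j) ⟩
  row s n e j                               ∎)

-- Cylindric pairs of rows and their raisings

PairPred : Set₁
PairPred = (ℕ → ℕ) → (ℕ → ℕ) → Set

Interlaced : (ℕ → ℕ) → (ℕ → ℕ) → ℕ → Set
Interlaced a b j = a (suc j) ≤ a j × b (suc j) ≤ b j × b (suc j) ≤ a j × a (suc j) ≤ b j

CylindricFrom : ℕ → PairPred
CylindricFrom k a b = ∀ j → k ≤ j → Interlaced a b j

Settled : ℕ → PairPred
Settled k a b = CylindricFrom k a b × (∀ j → j < k → a j ≡ a k ⊔ b k × b j ≡ a k ⊔ b k)

least : ℕ → (ℕ → ℕ) → (ℕ → ℕ) → ℕ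
least k a b = a (suc k) ⊔ b (suc k)

Interlaced⇔least≤ : ∀ a b j → Interlaced a b j ⇔ (least j a b ≤ a j × least j a b ≤ b j)
Interlaced⇔least≤ a b j = mk⇔
  (λ (aa , bb , ba , ab) → ⊔-lub aa ba , ⊔-lub ab bb)
  (λ (c≤a , c≤b) → ≤-trans (m≤m⊔n _ _) c≤a , ≤-trans (m≤n⊔m _ _) c≤b
                 , ≤-trans (m≤n⊔m _ _) c≤a , ≤-trans (m≤m⊔n _ _) c≤b)

cylindric-agree : ∀ {k a b a' b'} → (∀ j → k ≤ j → a' j ≡ a j) → (∀ j → k ≤ j → b' j ≡ b j) →
  CylindricFrom k a b → CylindricFrom k a' b'
cylindric-agree a'≡a b'≡b cyl j k≤j
  rewrite a'≡a j k≤j | a'≡a (suc j) (m≤n⇒m≤1+n k≤j) | b'≡b j k≤j | b'≡b (suc j) (m≤n⇒m≤1+n k≤j) = cyl j k≤j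

interlaced-null : ∀ a b j → a j ≡ 0 → a (suc j) ≡ 0 → b j ≡ 0 → b (suc j) ≡ 0 → Interlaced a b j
interlaced-null a b j a≡0 a'≡0 b≡0 b'≡0 rewrite a≡0 | a'≡0 | b≡0 | b'≡0 = z≤n , z≤n , z≤n , z≤n

Settled-null : ∀ k {a b} → (∀ j → a j ≡ 0) → (∀ j → b j ≡ 0) → Settled k a b
Settled-null k {a} {b} a≡0 b≡0 =
  (λ j _ → interlaced-null a b j (a≡0 j) (a≡0 (suc j)) (b≡0 j) (b≡0 (suc j))) ,
  (λ j _ → trans (a≡0 j) (sym top) , trans (b≡0 j) (sym top))
  where
  top : a k ⊔ b k ≡ 0
  top = cong₂ _⊔_ (a≡0 k) (b≡0 k)

Settled-null⁻ : ∀ k {a b} → (∀ j → k ≤ j → a j ≡ 0) → (∀ j → k ≤ j → b j ≡ 0) → Settled k a b →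
  ∀ j → a j ≡ 0 × b j ≡ 0
Settled-null⁻ k {a} {b} a≡0 b≡0 (_ , flat) j with j <? k
... | yes j<k = trans (proj₁ (flat j j<k)) top , trans (proj₂ (flat j j<k)) top
  where
  top : a k ⊔ b k ≡ 0
  top = cong₂ _⊔_ (a≡0 k ≤-refl) (b≡0 k ≤-refl)
... | no j≮k  = a≡0 j (≮⇒≥ j≮k) , b≡0 j (≮⇒≥ j≮k)

Settled-zero⇔CylindricFrom : ∀ a b → Settled 0 a b ⇔ CylindricFrom 0 a b
Settled-zero⇔CylindricFrom a b = mk⇔ proj₁ (λ cyl → cyl , λ _ ())

record Raised (k p h : ℕ) (a' a : ℕ → ℕ) : Set where
  field
    before : ∀ j → j < k → a j ≡ a' j + p
    at-k   : a k ≡ a' k + h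
    after  : ∀ j → k < j → a j ≡ a' j

Profile : ℕ → ℕ → ℕ → (ℕ → ℕ) → Set
Profile k p h = Raised k p h (λ _ → 0)

Raised-by-profile : ∀ {k p h a' a ρ} → (∀ j → a j ≡ a' j + ρ j) → Profile k p h ρ → Raised k p h a' a
Raised-by-profile {a' = a'} a≡a'+ρ ρ-profile = record
  { before = λ j j<k → trans (a≡a'+ρ j) (cong (a' j +_) (Raised.before ρ-profile j j<k))
  ; at-k   = trans (a≡a'+ρ _) (cong (a' _ +_) (Raised.at-k ρ-profile))
  ; after  = λ j k<j → trans (a≡a'+ρ j) (trans (cong (a' j +_) (Raised.after ρ-profile j k<j))
                                              (+-identityʳ (a' j)))
  }

Profile-≗ : ∀ {k p h ρ ρ'} → (∀ j → ρ' j ≡ ρ j) → Profile k p h ρ → Profile k p h ρ'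
Profile-≗ = Raised-by-profile

Profile-+ : ∀ {k p h p' h' ρ σ} → Profile k p h ρ → Profile k p' h' σ → Profile k (p + p') (h + h') (λ j → ρ j + σ j)
Profile-+ ρ-profile σ-profile = record
  { before = λ j j<k → cong₂ _+_ (Raised.before ρ-profile j j<k) (Raised.before σ-profile j j<k)
  ; at-k   = cong₂ _+_ (Raised.at-k ρ-profile) (Raised.at-k σ-profile)
  ; after  = λ j k<j → cong₂ _+_ (Raised.after ρ-profile j k<j) (Raised.after σ-profile j k<j)
  }

AtLeast : ℕ → ℕ → ℕ → (ℕ → ℕ) → Set
AtLeast k p h a = (∀ j → j < k → p ≤ a j) × h ≤ a k

profile-≤ : ∀ {k p h ρ a} → Profile k p h ρ → AtLeast k p h a → ∀ j → ρ j ≤ a j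
profile-≤ {k} {a = a} ρ-profile (p≤a , h≤a) j with <-cmp j k
... | tri< j<k _ _  = subst (_≤ a j) (sym (Raised.before ρ-profile j j<k)) (p≤a j j<k)
... | tri≈ _ refl _ = subst (_≤ a k) (sym (Raised.at-k ρ-profile)) h≤a
... | tri> _ _ k<j  = subst (_≤ a j) (sym (Raised.after ρ-profile j k<j)) z≤n

record Shape (k α β ℓ : ℕ) (a b : ℕ → ℕ) : Set where
  field
    cylindric : CylindricFrom (suc k) a b
    at-a      : a k ≡ α + least k a b
    at-b      : b k ≡ β + least k a b
    before-a  : ∀ j → j < k → a j ≡ ℓ + least k a b
    before-b  : ∀ j → j < k → b j ≡ ℓ + least k a b

excessᵃ excessᵇ : ℕ → (ℕ → ℕ) → (ℕ → ℕ) → ℕ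
excessᵃ k a b = a k ∸ least k a b
excessᵇ k a b = b k ∸ least k a b

Shape-reindex : ∀ {k α β ℓ α' β' ℓ' a b} → α ≡ α' → β ≡ β' → ℓ ≡ ℓ' →
  Shape k α β ℓ a b → Shape k α' β' ℓ' a b
Shape-reindex refl refl refl sh = sh

excessᵃ-shape : ∀ {k α β ℓ a b} → Shape k α β ℓ a b → excessᵃ k a b ≡ α
excessᵃ-shape {k} {α} {a = a} {b} sh = trans (cong (_∸ least k a b) (Shape.at-a sh)) (m+n∸n≡m α (least k a b))

excessᵇ-shape : ∀ {k α β ℓ a b} → Shape k α β ℓ a b → excessᵇ k a b ≡ β
excessᵇ-shape {k} {β = β} {a = a} {b} sh = trans (cong (_∸ least k a b) (Shape.at-b sh)) (m+n∸n≡m β (least k a b))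

module _ {k p h h' : ℕ} {a' a b' b : ℕ → ℕ} (ra : Raised k p h a' a) (rb : Raised k p h' b' b) where

  private
    c  = least k a b
    c' = least k a' b'

    c≡c' : c ≡ c'
    c≡c' = cong₂ _⊔_ (Raised.after ra (suc k) ≤-refl) (Raised.after rb (suc k) ≤-refl)

    raise-eq : ∀ {x x' δ γ} → x ≡ x' + δ → x' ≡ γ + c' → x ≡ (γ + δ) + c
    raise-eq {x} {x'} {δ} {γ} x≡x'+δ x'≡γ+c' = begin
      x            ≡⟨ x≡x'+δ ⟩
      x' + δ       ≡⟨ cong (_+ δ) x'≡γ+c' ⟩
      γ + c' + δ   ≡⟨ xy∙z≈xz∙y γ c' δ ⟩
      γ + δ + c'   ≡⟨ cong (γ + δ +_) c≡c' ⟨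
      γ + δ + c    ∎

    lower-eq : ∀ {x x' δ γ} → x ≡ x' + δ → x ≡ (γ + δ) + c → x' ≡ γ + c'
    lower-eq {x} {x'} {δ} {γ} x≡x'+δ x≡γ+δ+c = +-cancelʳ-≡ δ x' (γ + c') (begin
      x' + δ       ≡⟨ x≡x'+δ ⟨
      x            ≡⟨ x≡γ+δ+c ⟩
      γ + δ + c    ≡⟨ cong (γ + δ +_) c≡c' ⟩
      γ + δ + c'   ≡⟨ xy∙z≈xz∙y γ c' δ ⟨
      γ + c' + δ   ∎)

  Shape-raise : ∀ {α β ℓ} → Shape k α β ℓ a' b' → Shape k (α + h) (β + h') (ℓ + p) a b
  Shape-raise sh = record
    { cylindric = cylindric-agree (Raised.after ra) (Raised.after rb) (Shape.cylindric sh)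
    ; at-a      = raise-eq (Raised.at-k ra) (Shape.at-a sh)
    ; at-b      = raise-eq (Raised.at-k rb) (Shape.at-b sh)
    ; before-a  = λ j j<k → raise-eq (Raised.before ra j j<k) (Shape.before-a sh j j<k)
    ; before-b  = λ j j<k → raise-eq (Raised.before rb j j<k) (Shape.before-b sh j j<k)
    }

  Shape-lower : ∀ {α β ℓ} → Shape k (α + h) (β + h') (ℓ + p) a b → Shape k α β ℓ a' b'
  Shape-lower sh = record
    { cylindric = cylindric-agree (λ j k<j → sym (Raised.after ra j k<j)) (λ j k<j → sym (Raised.after rb j k<j))
                                  (Shape.cylindric sh)
    ; at-a      = lower-eq (Raised.at-k ra) (Shape.at-a sh)
    ; at-b      = lower-eq (Raised.at-k rb) (Shape.at-b sh)
    ; before-a  = λ j j<k → lower-eq (Raised.before ra j j<k) (Shape.before-a sh j j<k)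
    ; before-b  = λ j j<k → lower-eq (Raised.before rb j j<k) (Shape.before-b sh j j<k)
    }

record Lowering (k p h h' : ℕ) (Π : PairPred) (a b : ℕ → ℕ) : Set where
  field
    a-high : AtLeast k p h a
    b-high : AtLeast k p h' b
    lower  : ∀ {a' b'} → Raised k p h a' a → Raised k p h' b' b → Π a' b'

Lowering-map : ∀ {k p h h' Π Π' a b} → (∀ {a b} → Π a b → Π' a b) → Lowering k p h h' Π a b → Lowering k p h h' Π' a b
Lowering-map Π⇒Π' low = record
  { a-high = Lowering.a-high low
  ; b-high = Lowering.b-high low
  ; lower  = λ ra rb → Π⇒Π' (Lowering.lower low ra rb)
  }

Shape-lowering : ∀ {k p h h' a b} α β ℓ → Shape k (α + h) (β + h') (ℓ + p) a b →
  Lowering k p h h' (Shape k α β ℓ) a b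
Shape-lowering {k} {p} {h} {h'} {a} {b} α β ℓ sh = record
  { a-high = (λ j j<k → high (Shape.before-a sh j j<k)) , high (Shape.at-a sh)
  ; b-high = (λ j j<k → high (Shape.before-b sh j j<k)) , high (Shape.at-b sh)
  ; lower  = λ ra rb → Shape-lower ra rb sh
  }
  where
  high : ∀ {x γ δ} → x ≡ γ + δ + least k a b → δ ≤ x
  high {γ = γ} {δ} x≡ = subst (δ ≤_) (sym x≡) (≤-trans (m≤n+m δ γ) (m≤m+n (γ + δ) (least k a b)))

-- The four pieces of a factor

Flat : ℕ → PairPred
Flat k = Shape k 0 0 0

ExcessA ExcessB ExcessSum ExcessMax OneSided : ℕ → PairPred
ExcessA   k a b = ∃[ α ] Shape k α 0 α a b
ExcessB   k a b = ∃[ β ] Shape k 0 β β a b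
ExcessSum k a b = ∃[ α ] ∃[ β ] Shape k α β (α + β) a b
ExcessMax k a b = ∃[ α ] ∃[ β ] Shape k α β (α ⊔ β) a b
OneSided  k a b = ExcessA k a b ⊎ ExcessB k a b

Settled⇔Flat : ∀ k a b → Settled (suc k) a b ⇔ Flat k a b
Settled⇔Flat k a b = mk⇔ to from
  where
  to : Settled (suc k) a b → Flat k a b
  to (cyl , flat) = record
    { cylindric = cyl
    ; at-a      = proj₁ (flat k ≤-refl)
    ; at-b      = proj₂ (flat k ≤-refl)
    ; before-a  = λ j j<k → proj₁ (flat j (m<n⇒m<1+n j<k))
    ; before-b  = λ j j<k → proj₂ (flat j (m<n⇒m<1+n j<k))
    }
  from : Flat k a b → Settled (suc k) a b
  from sh = Shape.cylindric sh , flat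
    where
    flat : ∀ j → j < suc k → a j ≡ least k a b × b j ≡ least k a b
    flat j j<1+k with m<1+n⇒m<n∨m≡n j<1+k
    ... | inj₁ j<k  = Shape.before-a sh j j<k , Shape.before-b sh j j<k
    ... | inj₂ refl = Shape.at-a sh , Shape.at-b sh

ExcessMax⇔Settled : ∀ k a b → ExcessMax k a b ⇔ Settled k a b
ExcessMax⇔Settled k a b = mk⇔ to from
  where
  c : ℕ
  c = least k a b
  to : ExcessMax k a b → Settled k a b
  to (α , β , sh) = cyl , λ j j<k → trans (Shape.before-a sh j j<k) (sym top) ,
                                     trans (Shape.before-b sh j j<k) (sym top)
    where
    top : a k ⊔ b k ≡ (α ⊔ β) + c
    top = trans (cong₂ _⊔_ (Shape.at-a sh) (Shape.at-b sh)) (sym (+-distribʳ-⊔ c α β))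
    cyl : CylindricFrom k a b
    cyl j k≤j with m≤n⇒m<n∨m≡n k≤j
    ... | inj₁ k<j  = Shape.cylindric sh j k<j
    ... | inj₂ refl = Equivalence.from (Interlaced⇔least≤ a b k)
                        ( subst (c ≤_) (sym (Shape.at-a sh)) (m≤n+m c α)
                        , subst (c ≤_) (sym (Shape.at-b sh)) (m≤n+m c β))
  from : Settled k a b → ExcessMax k a b
  from (cyl , flat) = excessᵃ k a b , excessᵇ k a b , record
    { cylindric = λ j k<j → cyl j (<⇒≤ k<j)
    ; at-a      = a≡
    ; at-b      = b≡
    ; before-a  = λ j j<k → trans (proj₁ (flat j j<k)) top
    ; before-b  = λ j j<k → trans (proj₂ (flat j j<k)) top
    }
    where
    c≤a×c≤b : c ≤ a k × c ≤ b k
    c≤a×c≤b = Equivalence.to (Interlaced⇔least≤ a b k) (cyl k ≤-refl)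
    a≡ : a k ≡ (a k ∸ c) + c
    a≡ = sym (m∸n+n≡m (proj₁ c≤a×c≤b))
    b≡ : b k ≡ (b k ∸ c) + c
    b≡ = sym (m∸n+n≡m (proj₂ c≤a×c≤b))
    top : a k ⊔ b k ≡ ((a k ∸ c) ⊔ (b k ∸ c)) + c
    top = trans (cong₂ _⊔_ a≡ b≡) (sym (+-distribʳ-⊔ c (a k ∸ c) (b k ∸ c)))

ExcessB-lowering : ∀ {k a b} → ExcessB k a b → Lowering k (excessᵇ k a b) 0 (excessᵇ k a b) (Flat k) a b
ExcessB-lowering {k} {a} {b} (β , sh) =
  subst (λ q → Lowering k q 0 q (Flat k) a b) (sym (excessᵇ-shape sh)) (Shape-lowering 0 0 0 sh)

Flat-raise : ∀ {k q a' b' a b} → Raised k q 0 a' a → Raised k q q b' b → Flat k a' b' →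
  ExcessB k a b × q ≡ excessᵇ k a b
Flat-raise ra rb flat = (_ , sh) , sym (excessᵇ-shape sh)
  where
  sh = Shape-raise ra rb flat

ExcessSum-lowering : ∀ {k a b} → ExcessSum k a b → Lowering k (excessᵃ k a b) (excessᵃ k a b) 0 (ExcessB k) a b
ExcessSum-lowering {k} {a} {b} (α , β , sh) =
  subst (λ q → Lowering k q q 0 (ExcessB k) a b) (sym (excessᵃ-shape sh))
        (Lowering-map (β ,_) (Shape-lowering 0 β β (Shape-reindex refl (sym (+-identityʳ β)) (+-comm α β) sh)))

ExcessB-raise : ∀ {k q a' b' a b} → Raised k q q a' a → Raised k q 0 b' b → ExcessB k a' b' →
  ExcessSum k a b × q ≡ excessᵃ k a b
ExcessB-raise {q = q} ra rb (β , sh') = (q , β , sh) , sym (excessᵃ-shape sh)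
  where
  sh = Shape-reindex refl (+-identityʳ β) (+-comm β q) (Shape-raise ra rb sh')

OneSided⇒ExcessSum : ∀ {k a b} → OneSided k a b → ExcessSum k a b
OneSided⇒ExcessSum (inj₁ (α , sh)) = α , 0 , Shape-reindex refl refl (sym (+-identityʳ α)) sh
OneSided⇒ExcessSum (inj₂ (β , sh)) = 0 , β , sh

ExcessSum-split : ∀ {k a b} → ExcessSum k a b → OneSided k a b ⊎ Lowering k 2 1 1 (ExcessSum k) a b
ExcessSum-split (zero  , β     , sh) = inj₁ (inj₂ (β , sh))
ExcessSum-split (suc α , zero  , sh) = inj₁ (inj₁ (suc α , Shape-reindex refl refl (+-identityʳ (suc α)) sh))
ExcessSum-split (suc α , suc β , sh) = inj₂ (Lowering-map (λ sh → α , β , sh)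
  (Shape-lowering α β (α + β) (Shape-reindex (+-comm 1 α) (+-comm 1 β) (level α β) sh)))
  where
  level : ∀ α β → suc α + suc β ≡ α + β + 2
  level = solve-∀

ExcessSum-shift : ∀ {k a' b' a b} → Raised k 2 1 a' a → Raised k 2 1 b' b → ExcessSum k a' b' →
  ExcessSum k a b × ¬ OneSided k a b
ExcessSum-shift ra rb (α , β , sh') = (α + 1 , β + 1 , Shape-reindex refl refl (level α β) sh) , ¬one-sided
  where
  sh = Shape-raise ra rb sh'
  level : ∀ α β → α + β + 2 ≡ α + 1 + (β + 1)
  level = solve-∀
  ¬one-sided : ¬ OneSided _ _ _
  ¬one-sided (inj₁ (_ , sh₀)) = 1+n≢0 (trans (+-comm 1 β) (trans (sym (excessᵇ-shape sh)) (excessᵇ-shape sh₀)))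
  ¬one-sided (inj₂ (_ , sh₀)) = 1+n≢0 (trans (+-comm 1 α) (trans (sym (excessᵃ-shape sh)) (excessᵃ-shape sh₀)))

ExcessMax-lowering : ∀ {k a b} → ExcessMax k a b →
  let q = excessᵃ k a b ⊓ excessᵇ k a b in Lowering k q q q (OneSided k) a b
ExcessMax-lowering {k} {a} {b} (α , β , sh) =
  subst (λ q → Lowering k q q q (OneSided k) a b) (sym (cong₂ _⊓_ (excessᵃ-shape sh) (excessᵇ-shape sh)))
        (by-order (≤-total α β))
  where
  by-order : α ≤ β ⊎ β ≤ α → Lowering k (α ⊓ β) (α ⊓ β) (α ⊓ β) (OneSided k) a b
  by-order (inj₁ α≤β) =
    subst (λ q → Lowering k q q q (OneSided k) a b) (sym (m≤n⇒m⊓n≡m α≤β))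
          (Lowering-map (λ sh → inj₂ (β ∸ α , sh)) (Shape-lowering 0 (β ∸ α) (β ∸ α)
            (Shape-reindex refl (sym (m∸n+n≡m α≤β)) (trans (m≤n⇒m⊔n≡n α≤β) (sym (m∸n+n≡m α≤β))) sh)))
  by-order (inj₂ β≤α) =
    subst (λ q → Lowering k q q q (OneSided k) a b) (sym (m≥n⇒m⊓n≡n β≤α))
          (Lowering-map (λ sh → inj₁ (α ∸ β , sh)) (Shape-lowering (α ∸ β) 0 (α ∸ β)
            (Shape-reindex (sym (m∸n+n≡m β≤α)) refl (trans (m≥n⇒m⊔n≡m β≤α) (sym (m∸n+n≡m β≤α))) sh)))

OneSided-raise : ∀ {k q a' b' a b} → Raised k q q a' a → Raised k q q b' b → OneSided k a' b' →
  ExcessMax k a b × q ≡ excessᵃ k a b ⊓ excessᵇ k a b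
OneSided-raise {q = q} ra rb (inj₁ (α , sh')) =
  (α + q , q , Shape-reindex refl refl (sym (m≥n⇒m⊔n≡m q≤α+q)) sh) ,
  sym (trans (cong₂ _⊓_ (excessᵃ-shape sh) (excessᵇ-shape sh)) (m≥n⇒m⊓n≡n q≤α+q))
  where
  sh = Shape-raise ra rb sh'
  q≤α+q = m≤n+m q α
OneSided-raise {q = q} ra rb (inj₂ (β , sh')) =
  (q , β + q , Shape-reindex refl refl (sym (m≤n⇒m⊔n≡n q≤β+q)) sh) ,
  sym (trans (cong₂ _⊓_ (excessᵃ-shape sh) (excessᵇ-shape sh)) (m≤n⇒m⊓n≡m q≤β+q))
  where
  sh = Shape-raise ra rb sh'
  q≤β+q = m≤n+m q β

-- The monomial XY n (reach s k) (reach t k) has exponent 1 at every part before k, and at a_k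
-- (resp. b_k) exactly when s (resp. t) holds; its q-th power raises a_k by lift s q.
lift : Bool → ℕ → ℕ
lift false q = 0
lift true  q = q

reach : Bool → ℕ → ℕ
reach false k = k
reach true  k = suc k

prefix-profile : ∀ {n k} s q → k < n → Profile k q (lift s q) (λ j → q * at (prefixE n (reach s k)) j)
prefix-profile {n} {k} s q k<n = record
  { before = λ j j<k →
      trans (cong (q *_) (at-prefix-< n (reach s k) j (<-≤-trans j<k (k≤reach s)) (reach≤n s))) (*-identityʳ q)
  ; at-k   = at-k s
  ; after  = λ j k<j → trans (cong (q *_) (at-prefix-≥ n (reach s k) j (reach≤ s k<j))) (*-zeroʳ q)
  }
  where
  k≤reach : ∀ s → k ≤ reach s k
  k≤reach false = ≤-refl
  k≤reach true  = n≤1+n k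
  reach≤n : ∀ s → reach s k ≤ n
  reach≤n false = <⇒≤ k<n
  reach≤n true  = k<n
  reach≤ : ∀ s {j} → k < j → reach s k ≤ j
  reach≤ false k<j = <⇒≤ k<j
  reach≤ true  k<j = k<j
  at-k : ∀ s → q * at (prefixE n (reach s k)) k ≡ lift s q
  at-k false = trans (cong (q *_) (at-prefix-≥ n k k ≤-refl)) (*-zeroʳ q)
  at-k true  = trans (cong (q *_) (at-prefix-< n (suc k) k ≤-refl k<n)) (*-identityʳ q)

scaled-XY-profile : ∀ {n k} s t q → k < n →
  Profile k q (lift s q) (row first n (scale q (XY n (reach s k) (reach t k)))) ×
  Profile k q (lift t q) (row second n (scale q (XY n (reach s k) (reach t k))))
scaled-XY-profile {n} {k} s t q k<n =
  Profile-≗ (λ j → trans (scaled j first) (cong (q *_) (proj₁ (row-XY n (reach s k) (reach t k) j)))) (prefix-profile s q k<n) ,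
  Profile-≗ (λ j → trans (scaled j second) (cong (q *_) (proj₂ (row-XY n (reach s k) (reach t k) j)))) (prefix-profile t q k<n)
  where
  scaled : ∀ j side → row side n (scale q (XY n (reach s k) (reach t k))) j ≡ q * row side n (XY n (reach s k) (reach t k)) j
  scaled j side = row-map side n (q *_) (*-zeroʳ q) (XY n (reach s k) (reach t k)) j

XXYY-profile : ∀ {n k} s → k < n → Profile k 2 1 (row s n (XXYY n (suc k)))
XXYY-profile {n} {k} s k<n =
  Profile-≗ (λ j → trans (row-zipWith s n _+_ refl (XY n k k) (XY n (suc k) (suc k)) j)
                         (cong₂ _+_ (unit j k) (unit j (suc k))))
            (Profile-+ (prefix-profile false 1 k<n) (prefix-profile true 1 k<n))
  where
  unit : ∀ j i → row s n (XY n i i) j ≡ 1 * at (prefixE n i) j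
  unit j i = trans (side s) (sym (*-identityˡ _))
    where
    side : ∀ s → row s n (XY n i i) j ≡ at (prefixE n i) j
    side first  = proj₁ (row-XY n i i j)
    side second = proj₂ (row-XY n i i j)

onRows : ∀ n → PairPred → Exp (n + n) → Set
onRows n Π e = Π (row first n e) (row second n e)

rows-raised : ∀ n {k p h h'} {v e : Exp (n + n)} → v ≤v e →
  Profile k p h (row first n v) → Profile k p h' (row second n v) →
  Raised k p h (row first n (e ⊖ v)) (row first n e) × Raised k p h' (row second n (e ⊖ v)) (row second n e)
rows-raised n v≤e a-profile b-profile =
  Raised-by-profile (row-⊖ first n v≤e) a-profile , Raised-by-profile (row-⊖ second n v≤e) b-profile

≤v-by-profile : ∀ n {k p h h'} {v e : Exp (n + n)} →
  Profile k p h (row first n v) → Profile k p h' (row second n v) →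
  AtLeast k p h (row first n e) → AtLeast k p h' (row second n e) → v ≤v e
≤v-by-profile n {v = v} {e} a-profile b-profile a-high b-high = rows-≤⇒≤v n v e λ where
  first  → profile-≤ a-profile a-high
  second → profile-≤ b-profile b-high

geom-step : ∀ {n} k → k < n → (s t : Bool) {Π Π' : PairPred} (quota : (ℕ → ℕ) → (ℕ → ℕ) → ℕ) →
  (∀ {a b} → Π' a b → Lowering k (quota a b) (lift s (quota a b)) (lift t (quota a b)) Π a b) →
  (∀ {q a' b' a b} → Raised k q (lift s q) a' a → Raised k q (lift t q) b' b → Π a' b' → Π' a b × q ≡ quota a b) →
  ∀ {S} → Indicator S (onRows n Π) → Indicator (geom (XY n (reach s k) (reach t k)) *S S) (onRows n Π')
geom-step {n} k k<n s t {Π} {Π'} quota lowering raising S-Π =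
  geom-*S-indicator v (λ e → quota (row first n e) (row second n e)) S-Π split merge
  where
  v : Exp (n + n)
  v = XY n (reach s k) (reach t k)
  a-profile : ∀ q → Profile k q (lift s q) (row first n (scale q v))
  a-profile q = proj₁ (scaled-XY-profile s t q k<n)
  b-profile : ∀ q → Profile k q (lift t q) (row second n (scale q v))
  b-profile q = proj₂ (scaled-XY-profile s t q k<n)
  raised : ∀ {e} q → scale q v ≤v e →
    Raised k q (lift s q) (row first n (e ⊖ scale q v)) (row first n e) ×
    Raised k q (lift t q) (row second n (e ⊖ scale q v)) (row second n e)
  raised q qv≤e = rows-raised n qv≤e (a-profile q) (b-profile q)
  split : ∀ e → onRows n Π' e →
    let q = quota (row first n e) (row second n e) in scale q v ≤v e × onRows n Π (e ⊖ scale q v)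
  split e π' = qv≤e , Lowering.lower low (proj₁ (raised q qv≤e)) (proj₂ (raised q qv≤e))
    where
    q = quota (row first n e) (row second n e)
    low = lowering π'
    qv≤e = ≤v-by-profile n (a-profile q) (b-profile q) (Lowering.a-high low) (Lowering.b-high low)
  merge : ∀ e q → scale q v ≤v e → onRows n Π (e ⊖ scale q v) →
    onRows n Π' e × q ≡ quota (row first n e) (row second n e)
  merge e q qv≤e = raising (proj₁ (raised q qv≤e)) (proj₂ (raised q qv≤e))

one-minus-step : ∀ {n} k → k < n → {Π Π' : PairPred} →
  (∀ {a b} → Π' a b → Π a b) →
  (∀ {a b} → Π a b → Π' a b ⊎ Lowering k 2 1 1 Π a b) →
  (∀ {a' b' a b} → Raised k 2 1 a' a → Raised k 2 1 b' b → Π a' b' → Π a b × ¬ Π' a b) →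
  ∀ {S} → Indicator S (onRows n Π) → Indicator ((oneS -S mono (XXYY n (suc k))) *S S) (onRows n Π')
one-minus-step {n} k k<n {Π} {Π'} Π'⇒Π split shift S-Π =
  one-minus-mono-*S-indicator u S-Π (λ _ → Π'⇒Π) split-rows shifted
  where
  u : Exp (n + n)
  u = XXYY n (suc k)
  raised : ∀ {e} → u ≤v e →
    Raised k 2 1 (row first n (e ⊖ u)) (row first n e) × Raised k 2 1 (row second n (e ⊖ u)) (row second n e)
  raised u≤e = rows-raised n u≤e (XXYY-profile first k<n) (XXYY-profile second k<n)
  split-rows : ∀ e → onRows n Π e → onRows n Π' e ⊎ (u ≤v e × onRows n Π (e ⊖ u))
  split-rows e π with split π
  ... | inj₁ π'  = inj₁ π'
  ... | inj₂ low = inj₂ (u≤e , Lowering.lower low (proj₁ (raised u≤e)) (proj₂ (raised u≤e)))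
    where
    u≤e = ≤v-by-profile n (XXYY-profile first k<n) (XXYY-profile second k<n) (Lowering.a-high low) (Lowering.b-high low)
  shifted : ∀ e → u ≤v e → onRows n Π (e ⊖ u) → onRows n Π e × ¬ onRows n Π' e
  shifted e u≤e = shift (proj₁ (raised u≤e)) (proj₂ (raised u≤e))

factor-step : ∀ {n} k → k < n → {T : PS (n + n)} →
  Indicator T (onRows n (Settled (suc k))) → Indicator (factor n (suc k) *S T) (onRows n (Settled k))
factor-step {n} k k<n {T} T-ind =
  Indicator-cong (λ e → sym (*S-reorder (oneS -S mono (XXYY n (suc k))) (geom (XY n (suc k) k))
                                          (geom (XY n k (suc k))) (geom (XY n (suc k) (suc k))) T e))
    (Indicator-⇔ (λ _ → ExcessMax⇔Settled k _ _)
      (geom-step k k<n true true (λ a b → excessᵃ k a b ⊓ excessᵇ k a b) ExcessMax-lowering OneSided-raise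
        (one-minus-step k k<n OneSided⇒ExcessSum ExcessSum-split ExcessSum-shift
          (geom-step k k<n true false (excessᵃ k) ExcessSum-lowering ExcessB-raise
            (geom-step k k<n false true (excessᵇ k) ExcessB-lowering Flat-raise
              (Indicator-⇔ (λ _ → Settled⇔Flat k _ _) T-ind))))))

zeros⇔Settled : ∀ n (e : Exp (n + n)) → (replicate (n + n) 0 ≡ e) ⇔ onRows n (Settled n) e
zeros⇔Settled n e = mk⇔ (λ { refl → Settled-null n (row-zeros first n) (row-zeros second n) }) from
  where
  from : onRows n (Settled n) e → replicate (n + n) 0 ≡ e
  from settled = rows-ext n _ e λ s j → trans (row-zeros s n j) (sym (side s j))
    where
    null : ∀ j → row first n e j ≡ 0 × row second n e j ≡ 0
    null = Settled-null⁻ n (row-beyond first n e) (row-beyond second n e) settled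
    side : ∀ s j → row s n e j ≡ 0
    side first  j = proj₁ (null j)
    side second j = proj₂ (null j)

T-≤ᵇ : ∀ {m n} → T (m ≤ᵇ n) ⇔ m ≤ n
T-≤ᵇ = mk⇔ (≤ᵇ⇒≤ _ _) ≤⇒≤ᵇ

isCP⇔CylindricFrom : ∀ n (e : Exp (n + n)) → T (isCP (half first n e) (half second n e)) ⇔ onRows n (CylindricFrom 0) e
isCP⇔CylindricFrom n e = mk⇔ to from
  where
  a = row first n e
  b = row second n e
  interlacedᵇ : ℕ → Bool
  interlacedᵇ j = (a (suc j) ≤ᵇ a j) ∧ (b (suc j) ≤ᵇ b j) ∧ (b (suc j) ≤ᵇ a j) ∧ (a (suc j) ≤ᵇ b j)
  T-interlacedᵇ : ∀ j → T (interlacedᵇ j) ⇔ Interlaced a b j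
  T-interlacedᵇ j = ⇔-trans T-∧ (T-≤ᵇ ×-⇔ ⇔-trans T-∧ (T-≤ᵇ ×-⇔ ⇔-trans T-∧ (T-≤ᵇ ×-⇔ T-≤ᵇ)))
  to : T (isCP (half first n e) (half second n e)) → CylindricFrom 0 a b
  to isCP j _ with j <? n
  ... | yes j<n = Equivalence.to (T-interlacedᵇ j) (applyUpTo⁻ id n (all⁺ interlacedᵇ (upTo n) isCP) j<n)
  ... | no j≮n  = interlaced-null a b j (row-beyond first n e j n≤j) (row-beyond first n e (suc j) n≤1+j)
                                    (row-beyond second n e j n≤j) (row-beyond second n e (suc j) n≤1+j)
    where
    n≤j : n ≤ j
    n≤j = ≮⇒≥ j≮n
    n≤1+j : n ≤ suc j
    n≤1+j = m≤n⇒m≤1+n n≤j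
  from : CylindricFrom 0 a b → T (isCP (half first n e) (half second n e))
  from cyl = all⁻ interlacedᵇ (applyUpTo⁺₁ id n (λ {j} _ → Equivalence.from (T-interlacedᵇ j) (cyl j z≤n)))

factors-indicator : ∀ {n} m k → m + k ≡ n → (f : ℕ → ℕ) → (∀ j → f j ≡ k + j) →
  Indicator (prodS (map (λ j → factor n (suc j)) (applyUpTo f m))) (onRows n (Settled k))
factors-indicator {n} zero k refl f _ = Indicator-⇔ (zeros⇔Settled n) (mono-indicator (replicate (n + n) 0))
factors-indicator {n} (suc m) k 1+m+k≡n f f≡k+ =
  subst (λ i → Indicator (factor n (suc i) *S rest) (onRows n (Settled k))) (sym f0≡k) (factor-step k k<n rest-indicator)
  where
  rest : PS (n + n)
  rest = prodS (map (λ j → factor n (suc j)) (applyUpTo (f ∘ suc) m))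
  rest-indicator : Indicator rest (onRows n (Settled (suc k)))
  rest-indicator = factors-indicator m (suc k) (trans (+-suc m k) 1+m+k≡n) (f ∘ suc) (λ j → trans (f≡k+ (suc j)) (+-suc k j))
  f0≡k : f 0 ≡ k
  f0≡k = trans (f≡k+ 0) (+-identityʳ k)
  k<n : k < n
  k<n = subst (k <_) 1+m+k≡n (s≤s (m≤n+m k m))

theorem3p2 : (n : ℕ) → 1 ≤ n → (e : Exp (n Data.Nat.+ n)) → CP n e ≡ RHS n e
theorem3p2 n _ = Indicator-unique CP-indicator RHS-indicator
  where
  CP-indicator : Indicator (CP n) (onRows n (CylindricFrom 0))
  CP-indicator = boolℤ-indicator _ (isCP⇔CylindricFrom n)
  RHS-indicator : Indicator (RHS n) (onRows n (CylindricFrom 0))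
  RHS-indicator = Indicator-⇔ (λ _ → Settled-zero⇔CylindricFrom _ _)
                              (factors-indicator n 0 (+-identityʳ n) id (λ _ → refl))
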